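{- There exist a planar GTSP instance with Euclidean distances and a tour $T$ of it such that $T$ is a local minimum in $N_{\text{2-opt G}}(T)$ but $T$ is not a local minimum in $N_{\text{swap L}}(T)$ (and hence not in $N_{\text{swap G}}(T)$).
   Context: A GTSP instance: a complete graph on vertex set $V$ with edge weights $w(x\to y)$ and a partition of $V$ into clusters; here vertices are points in the plane and $w$ is Euclidean distance. A tour is a cycle $T=T_1\to\dots\to T_m\to T_1$ visiting exactly one vertex of each cluster; its weight is the sum of its edge weights. For a tour $T$, $N_{\mathrm{CO}}(T)$ is the set of tours visiting the clusters in the same cyclic order as $T$ with arbitrary vertex choice in each cluster. $N_{\text{2-opt}}(T)$ is the set of tours obtained from $T$ by removing two edges and adding two edges (on the sequence of visited vertices); $N_{\text{2-opt G}}(T)=\bigcup_{T'\in N_{\text{2-opt}}(T)}N_{\mathrm{CO}}(T')$. $N_{\mathrm{swap}}(T)$ is the set of tours obtained by exchanging the positions of two vertices $T_x,T_y$; $N_{\text{swap L}}(T)$ is the set of tours obtained by such an exchange followed by replacing the two exchanged vertices by arbitrary vertices of their respective clusters; $N_{\text{swap G}}(T)=\bigcup_{T'\in N_{\mathrm{swap}}(T)}N_{\mathrm{CO}}(T')$. $T$ is a local minimum in $N(T)$ if no tour in $N(T)$ has strictly smaller weight. -}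

module Defs where

open import Data.Nat using (ℕ; _+_; _*_; _≤_; _<_)
open import Data.Integer as ℤ using (ℤ; ∣_∣)
open import Data.Fin using (Fin)
open import Data.List using (List; []; _∷_; _++_; map; reverse; allFin; [_])
open import Data.Nat.ListAction using (sum)
open import Data.List.Relation.Binary.Pointwise using (Pointwise)
open import Data.List.Relation.Binary.Permutation.Propositional using (_↭_)
open import Data.Product using (_×_; _,_; ∃; ∃-syntax; Σ)
open import Relation.Binary.PropositionalEquality using (_≡_)
open import Relation.Nullary using (¬_)
open import Function.Definitions using (Surjective)

-- SqrtSumLt as bs  means  Σ_{a∈as} √a  <  Σ_{b∈bs} √b  (as reals).  This is an exact characterisation of the strict
-- real inequality (rounding errors vanish as k → ∞).

SqrtSumLt : List ℕ → List ℕ → Set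
SqrtSumLt as bs =
  ∃[ k ] ∃[ us ] ∃[ ls ]
    ( Pointwise (λ a u → a * (k * k) ≤ u * u) as us
    × Pointwise (λ l b → l * l ≤ b * (k * k)) ls bs
    × sum us < sum ls )

Point : Set
Point = ℤ × ℤ

dist² : Point → Point → ℕ
dist² (x₁ , y₁) (x₂ , y₂) =
  ∣ x₁ ℤ.- x₂ ∣ * ∣ x₁ ℤ.- x₂ ∣ + ∣ y₁ ℤ.- y₂ ∣ * ∣ y₁ ℤ.- y₂ ∣

record Instance : Set where
  field
    n        : ℕ
    m        : ℕ
    pos      : Fin n → Point
    cluster  : Fin n → Fin m
    nonempty : Surjective _≡_ _≡_ cluster

module _ (I : Instance) where
  open Instance I

  Tour : Set
  Tour = List (Fin n)

  IsTour : Tour → Set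
  IsTour T = map cluster T ↭ allFin m

  cycEdges : Fin n → Tour → List ℕ
  cycEdges f [] = []
  cycEdges f (y ∷ []) = dist² (pos y) (pos f) ∷ []
  cycEdges f (y ∷ z ∷ r) = dist² (pos y) (pos z) ∷ cycEdges f (z ∷ r)

  edges² : Tour → List ℕ
  edges² [] = []
  edges² (x ∷ xs) = cycEdges x (x ∷ xs)

  Lighter : Tour → Tour → Set
  Lighter T' T = SqrtSumLt (edges² T') (edges² T)

  NCO : Tour → Tour → Set
  NCO T T' = map cluster T' ≡ map cluster T

  -- N_2-opt: remove two edges, add two edges = reverse a segment
  N2opt : Tour → Tour → Set
  N2opt T T' = ∃[ A ] ∃[ B ] ∃[ C ] (T ≡ A ++ B ++ C × T' ≡ A ++ reverse B ++ C)

  N2optG : Tour → Tour → Set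
  N2optG T T'' = ∃[ T' ] (N2opt T T' × NCO T' T'')

  NswapL : Tour → Tour → Set
  NswapL T T' =
    ∃[ A ] ∃[ u ] ∃[ B ] ∃[ v ] ∃[ C ] ∃[ u' ] ∃[ v' ]
      ( T ≡ A ++ u ∷ B ++ v ∷ C
      × T' ≡ A ++ v' ∷ B ++ u' ∷ C
      × cluster u' ≡ cluster u
      × cluster v' ≡ cluster v )

  LocalMin : (Tour → Tour → Set) → Tour → Set
  LocalMin N T = ∀ T' → N T T' → ¬ Lighter T' T

{-# OPTIONS --safe #-}

-- Seven points suffice: the cluster {(1,3), (4,2)} has two vertices and all
-- other clusters are singletons. The tour T₀ through (1,0), (0,0), (1,3), (3,4),
-- (4,4), (1,1) has weight 3 + √10 + √5 + √18 ≈ 12.641. Exchanging (1,3) with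
-- (1,1) and then replacing (1,3) by (4,2) gives weight 4 + √2 + 2√13 ≈ 12.626,
-- whereas no 2-opt move followed by a change of vertices within clusters improves
-- T₀. The latter is checked over the whole (finite) 2-opt-G neighbourhood: a
-- neighbour with the same multiset of edge lengths as T₀ has the same weight, and
-- every other one is separated from T₀ by integer bounds on 10⁶·√d for its
-- squared edge lengths d; after rescaling, such bounds refute a witness of
-- SqrtSumLt at any scale.

module Submission where

open import Defs
open import Data.Fin using (Fin; #_; inject₁)
open import Data.Fin.Properties using (all?)
open import Data.List using (List; []; _∷_; [_]; _++_; map; reverse; concatMap;
  cartesianProductWith)
open import Data.List.Properties using (≡-dec)
open import Data.List.Membership.Propositional using (_∈_)
open import Data.List.Membership.Propositional.Properties using (∈-map⁺; ∈-concat⁺′;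
  ∈-cartesianProductWith⁺)
open import Data.List.Relation.Binary.Permutation.Propositional using (_↭_; refl; prep;
  swap; trans; ↭-sym)
open import Data.List.Relation.Binary.Pointwise as Pointwise using (Pointwise; []; _∷_)
open import Data.List.Relation.Unary.All as All using (All)
open import Data.List.Relation.Unary.Any using (here; there; any?)
open import Data.Nat using (ℕ; zero; suc; _+_; _*_; _^_; _≤_; _<_; _≤?_; _<?_; _≟_; z≤n;
  NonZero)
open import Data.Nat.DivMod using (_/_)
open import Data.Nat.ListAction using (sum)
open import Data.Nat.ListAction.Properties using (sum-↭)
open import Data.Nat.Properties
open import Data.List.Sort.InsertionSort.Base ≤-decTotalOrder using (sort)
open import Data.List.Sort.InsertionSort.Properties ≤-decTotalOrder using (sort-↭)
open import Data.Nat.Tactic.RingSolver using (solve-∀)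
open import Data.Integer using (+_)
open import Data.Sum using (_⊎_; inj₁; inj₂)
open import Data.Product using (_×_; _,_; ∃-syntax; proj₁; proj₂; map₁)
open import Data.Vec using (Vec; []; _∷_; lookup)
open import Relation.Binary.PropositionalEquality using (_≡_; refl; cong; subst)
  renaming (trans to ≡-trans)
open import Relation.Nullary using (¬_; Dec; yes; no; contradiction)
open import Relation.Nullary.Decidable using (toWitness; _⊎-dec_)

m*m≤n*n⇒m≤n : ∀ {m n} → m * m ≤ n * n → m ≤ n
m*m≤n*n⇒m≤n {m} {n} m*m≤n*n with m ≤? n
... | yes m≤n = m≤n
... | no m≰n = contradiction m*m≤n*n (<⇒≱ (*-mono-< (≰⇒> m≰n) (≰⇒> m≰n)))

*-rescale-≤ : ∀ {x a y p q} → x * x ≤ a * (p * p) → a * (q * q) ≤ y * y →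
              x * q ≤ y * p
*-rescale-≤ {x} {a} {y} {p} {q} x²≤ap² aq²≤y² = m*m≤n*n⇒m≤n (begin
  (x * q) * (x * q)       ≡⟨ square-* x q ⟩
  (x * x) * (q * q)       ≤⟨ *-monoˡ-≤ (q * q) x²≤ap² ⟩
  (a * (p * p)) * (q * q) ≡⟨ *-swapʳ a (p * p) (q * q) ⟩
  (a * (q * q)) * (p * p) ≤⟨ *-monoˡ-≤ (p * p) aq²≤y² ⟩
  (y * y) * (p * p)       ≡⟨ square-* y p ⟨
  (y * p) * (y * p)       ∎)
  where
  open ≤-Reasoning
  square-* : ∀ m n → (m * n) * (m * n) ≡ (m * m) * (n * n)
  square-* = solve-∀
  *-swapʳ : ∀ m n o → (m * n) * o ≡ (m * o) * n
  *-swapʳ = solve-∀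

sum-mono-≤ : ∀ {ms ns} → Pointwise _≤_ ms ns → sum ms ≤ sum ns
sum-mono-≤ [] = z≤n
sum-mono-≤ (m≤n ∷ ms≤ns) = +-mono-≤ m≤n (sum-mono-≤ ms≤ns)

sum-*-mono-≤ : ∀ {p q ms ns} → Pointwise (λ m n → m * q ≤ n * p) ms ns →
               sum ms * q ≤ sum ns * p
sum-*-mono-≤ [] = z≤n
sum-*-mono-≤ {p} {q} {m ∷ ms} {n ∷ ns} (mq≤np ∷ rest) = begin
  (m + sum ms) * q     ≡⟨ *-distribʳ-+ q m (sum ms) ⟩
  m * q + sum ms * q   ≤⟨ +-mono-≤ mq≤np (sum-*-mono-≤ rest) ⟩
  n * p + sum ns * p   ≡⟨ *-distribʳ-+ p n (sum ns) ⟨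
  (n + sum ns) * p     ∎
  where open ≤-Reasoning

pointwise-↭ʳ : ∀ {A B : Set} {R : A → B → Set} {xs ys zs} →
               Pointwise R xs ys → ys ↭ zs → ∃[ ws ] (xs ↭ ws × Pointwise R ws zs)
pointwise-↭ʳ rs refl = _ , refl , rs
pointwise-↭ʳ (r ∷ rs) (prep _ ys↭zs) =
  let ws , xs↭ws , rs′ = pointwise-↭ʳ rs ys↭zs in _ , prep _ xs↭ws , r ∷ rs′
pointwise-↭ʳ (r₁ ∷ r₂ ∷ rs) (swap _ _ ys↭zs) =
  let ws , xs↭ws , rs′ = pointwise-↭ʳ rs ys↭zs in _ , swap _ _ xs↭ws , r₂ ∷ r₁ ∷ rs′
pointwise-↭ʳ rs (trans ys↭zs zs↭zs′) =
  let ws , xs↭ws , rs′ = pointwise-↭ʳ rs ys↭zs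
      ws′ , ws↭ws′ , rs″ = pointwise-↭ʳ rs′ zs↭zs′
  in ws′ , trans xs↭ws ws↭ws′ , rs″

¬sqrtSumLt-↭ : ∀ {as bs} → bs ↭ as → ¬ SqrtSumLt as bs
¬sqrtSumLt-↭ bs↭as (k , us , ls , as≤us , ls≤bs , Σus<Σls) =
  let ls′ , ls↭ls′ , ls′≤as = pointwise-↭ʳ ls≤bs bs↭as
      ls′≤us = Pointwise.transitive (λ l²≤a a≤u² → m*m≤n*n⇒m≤n (≤-trans l²≤a a≤u²))
                                    ls′≤as as≤us
  in <⇒≱ Σus<Σls (≤-trans (≤-reflexive (sum-↭ ls↭ls′)) (sum-mono-≤ ls′≤us))

IsSqrtBracket : ℕ → ℕ × ℕ → Set
IsSqrtBracket n b = proj₁ b * proj₁ b ≤ n × n < proj₂ b * proj₂ b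

midpoint : ℕ → ℕ → ℕ
midpoint l h = (l + h) / 2

-- The fuel only affects the width of the resulting bracket, not its soundness.
bisect : ℕ → ℕ → ℕ → ℕ → ℕ × ℕ
bisect n zero l h = l , h
bisect n (suc fuel) l h with midpoint l h * midpoint l h ≤? n
... | yes _ = bisect n fuel (midpoint l h) h
... | no _ = bisect n fuel l (midpoint l h)

bisect-sound : ∀ n fuel {l h} → IsSqrtBracket n (l , h) →
               IsSqrtBracket n (bisect n fuel l h)
bisect-sound n zero bracket = bracket
bisect-sound n (suc fuel) {l} {h} (l²≤n , n<h²) with midpoint l h * midpoint l h ≤? n
... | yes mid²≤n = bisect-sound n fuel (mid²≤n , n<h²)
... | no mid²≰n = bisect-sound n fuel (l²≤n , ≰⇒> mid²≰n)

√-bracket : ℕ → ℕ × ℕ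
√-bracket n = bisect n 64 0 (suc n)

√-bracket-sound : ∀ n → IsSqrtBracket n (√-bracket n)
√-bracket-sound n =
  bisect-sound n 64 {0} {suc n} (z≤n , <-≤-trans (n<1+n n) (m≤m*n (suc n) (suc n)))

module ScaledSqrtBounds (K : ℕ) .{{_ : NonZero K}} where

  ⌊K√_⌋ ⌈K√_⌉ : ℕ → ℕ
  ⌊K√ a ⌋ = proj₁ (√-bracket (a * (K * K)))
  ⌈K√ a ⌉ = proj₂ (√-bracket (a * (K * K)))

  ⌊K√⌋-pointwise : ∀ as → Pointwise (λ l a → l * l ≤ a * (K * K)) (map ⌊K√_⌋ as) as
  ⌊K√⌋-pointwise [] = []
  ⌊K√⌋-pointwise (a ∷ as) = proj₁ (√-bracket-sound (a * (K * K))) ∷ ⌊K√⌋-pointwise as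

  ⌈K√⌉-pointwise : ∀ as → Pointwise (λ a u → a * (K * K) ≤ u * u) as (map ⌈K√_⌉ as)
  ⌈K√⌉-pointwise [] = []
  ⌈K√⌉-pointwise (a ∷ as) =
    <⇒≤ (proj₂ (√-bracket-sound (a * (K * K)))) ∷ ⌈K√⌉-pointwise as

  sqrtSumLt-by-bounds : ∀ as bs → sum (map ⌈K√_⌉ as) < sum (map ⌊K√_⌋ bs) →
                        SqrtSumLt as bs
  sqrtSumLt-by-bounds as bs Σ⌈as⌉<Σ⌊bs⌋ =
    K , _ , _ , ⌈K√⌉-pointwise as , ⌊K√⌋-pointwise bs , Σ⌈as⌉<Σ⌊bs⌋

  ¬sqrtSumLt-by-bounds : ∀ as bs → sum (map ⌈K√_⌉ bs) ≤ sum (map ⌊K√_⌋ as) →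
                         ¬ SqrtSumLt as bs
  ¬sqrtSumLt-by-bounds as bs Σ⌈bs⌉≤Σ⌊as⌋ (k , us , ls , as≤us , ls≤bs , Σus<Σls) =
    <⇒≱ Σus<Σls (*-cancelʳ-≤ (sum ls) (sum us) K (begin
      sum ls * K              ≤⟨ sum-*-mono-≤ ls≤⌈bs⌉ ⟩
      sum (map ⌈K√_⌉ bs) * k  ≤⟨ *-monoˡ-≤ k Σ⌈bs⌉≤Σ⌊as⌋ ⟩
      sum (map ⌊K√_⌋ as) * k  ≤⟨ sum-*-mono-≤ ⌊as⌋≤us ⟩
      sum us * K              ∎))
    where
    open ≤-Reasoning
    ls≤⌈bs⌉ : Pointwise (λ l u → l * K ≤ u * k) ls (map ⌈K√_⌉ bs)
    ls≤⌈bs⌉ = Pointwise.transitive (λ {l b u} → *-rescale-≤ {l} {b} {u} {k} {K})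
                                   ls≤bs (⌈K√⌉-pointwise bs)
    ⌊as⌋≤us : Pointwise (λ l u → l * k ≤ u * K) (map ⌊K√_⌋ as) us
    ⌊as⌋≤us = Pointwise.transitive (λ {l a u} → *-rescale-≤ {l} {a} {u} {K} {k})
                                   (⌊K√⌋-pointwise as) as≤us

  SqrtSumGeCertificate : List ℕ → List ℕ → Set
  SqrtSumGeCertificate as bs =
    sort as ≡ sort bs ⊎ sum (map ⌈K√_⌉ bs) ≤ sum (map ⌊K√_⌋ as)

  sqrtSumGeCertificate? : ∀ as bs → Dec (SqrtSumGeCertificate as bs)
  sqrtSumGeCertificate? as bs =
    ≡-dec _≟_ (sort as) (sort bs) ⊎-dec sum (map ⌈K√_⌉ bs) ≤? sum (map ⌊K√_⌋ as)

  ¬sqrtSumLt-by-certificate : ∀ {as bs} → SqrtSumGeCertificate as bs → ¬ SqrtSumLt as bs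
  ¬sqrtSumLt-by-certificate {as} {bs} (inj₁ sort≡) =
    ¬sqrtSumLt-↭ (trans (↭-sym (sort-↭ bs)) (subst (_↭ as) sort≡ (sort-↭ as)))
  ¬sqrtSumLt-by-certificate {as} {bs} (inj₂ Σ⌈bs⌉≤Σ⌊as⌋) =
    ¬sqrtSumLt-by-bounds as bs Σ⌈bs⌉≤Σ⌊as⌋

splits : {A : Set} → List A → List (List A × List A)
splits [] = [ [] , [] ]
splits (x ∷ xs) = ([] , x ∷ xs) ∷ map (map₁ (x ∷_)) (splits xs)

splits-complete : ∀ {A : Set} (xs ys : List A) → (xs , ys) ∈ splits (xs ++ ys)
splits-complete [] [] = here refl
splits-complete [] (y ∷ ys) = here refl
splits-complete (x ∷ xs) ys = there (∈-map⁺ (map₁ (x ∷_)) (splits-complete xs ys))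

segmentReversals : {A : Set} → List A → List (List A)
segmentReversals xs =
  concatMap (λ (as , bcs) → map (λ (bs , cs) → as ++ reverse bs ++ cs) (splits bcs))
            (splits xs)

segmentReversals-complete : ∀ {A : Set} (as bs cs : List A) →
                            as ++ reverse bs ++ cs ∈ segmentReversals (as ++ bs ++ cs)
segmentReversals-complete as bs cs =
  ∈-concat⁺′ (∈-map⁺ _ (splits-complete bs cs)) (∈-map⁺ _ (splits-complete as (bs ++ cs)))

module TwoOptGEnumeration
  (I : Instance)
  (members : Fin (Instance.m I) → List (Fin (Instance.n I)))
  (members-complete : ∀ v → v ∈ members (Instance.cluster I v))
  where

  open Instance I

  withClusters : List (Fin m) → List (Tour I)
  withClusters [] = [ [] ]
  withClusters (c ∷ cs) = cartesianProductWith _∷_ (members c) (withClusters cs)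

  withClusters-complete : ∀ t → t ∈ withClusters (map cluster t)
  withClusters-complete [] = here refl
  withClusters-complete (v ∷ t) =
    ∈-cartesianProductWith⁺ _∷_ (members-complete v) (withClusters-complete t)

  twoOptGCandidates : Tour I → List (Tour I)
  twoOptGCandidates t =
    concatMap (λ t′ → withClusters (map cluster t′)) (segmentReversals t)

  N2optG⇒∈candidates : ∀ {t t″} → N2optG I t t″ → t″ ∈ twoOptGCandidates t
  N2optG⇒∈candidates {t″ = t″} (_ , (as , bs , cs , refl , refl) , sameClusters) =
    ∈-concat⁺′ (subst (λ c → t″ ∈ withClusters c) sameClusters (withClusters-complete t″))
               (∈-map⁺ _ (segmentReversals-complete as bs cs))

  localMin-by-enumeration : ∀ t → All (λ t′ → ¬ Lighter I t′ t) (twoOptGCandidates t) →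
                            LocalMin I (N2optG I) t
  localMin-by-enumeration t notLighter t″ t→t″ =
    All.lookup notLighter (N2optG⇒∈candidates t→t″)

positions : Vec Point 7
positions = (+ 1 , + 0) ∷ (+ 0 , + 0) ∷ (+ 1 , + 3) ∷ (+ 3 , + 4) ∷ (+ 4 , + 4)
          ∷ (+ 1 , + 1) ∷ (+ 4 , + 2) ∷ []

clusters : Vec (Fin 6) 7
clusters = # 0 ∷ # 1 ∷ # 2 ∷ # 3 ∷ # 4 ∷ # 5 ∷ # 2 ∷ []

members : Fin 6 → List (Fin 7)
members = lookup ([ # 0 ] ∷ [ # 1 ] ∷ (# 2 ∷ # 6 ∷ []) ∷ [ # 3 ] ∷ [ # 4 ] ∷ [ # 5 ] ∷ [])

members-complete : ∀ v → v ∈ members (lookup clusters v)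
members-complete =
  toWitness {a? = all? (λ v → any? (v Data.Fin.≟_) (members (lookup clusters v)))} _

lookup-clusters-inject₁ : ∀ c → lookup clusters (inject₁ c) ≡ c
lookup-clusters-inject₁ =
  toWitness {a? = all? (λ c → lookup clusters (inject₁ c) Data.Fin.≟ c)} _

I₇ : Instance
I₇ = record
  { n = 7 ; m = 6 ; pos = lookup positions ; cluster = lookup clusters
  ; nonempty = λ c → inject₁ c , λ z≡ → ≡-trans (cong (lookup clusters) z≡)
                                                 (lookup-clusters-inject₁ c)
  }

T₀ T₁ : Tour I₇
T₀ = # 0 ∷ # 1 ∷ # 2 ∷ # 3 ∷ # 4 ∷ # 5 ∷ []
T₁ = # 0 ∷ # 1 ∷ # 5 ∷ # 3 ∷ # 4 ∷ # 6 ∷ []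

open ScaledSqrtBounds (10 ^ 6)
open TwoOptGEnumeration I₇ members members-complete

T₀-localMin-2optG : LocalMin I₇ (N2optG I₇) T₀
T₀-localMin-2optG = localMin-by-enumeration T₀ (All.map ¬sqrtSumLt-by-certificate
  (toWitness {a? = All.all? (λ t → sqrtSumGeCertificate? (edges² I₇ t) (edges² I₇ T₀))
                            (twoOptGCandidates T₀)} _))

T₀-swapL-T₁ : NswapL I₇ T₀ T₁
T₀-swapL-T₁ =
  # 0 ∷ # 1 ∷ [] , # 2 , # 3 ∷ # 4 ∷ [] , # 5 , [] , # 6 , # 5 , refl , refl , refl , refl

T₁-lighter : Lighter I₇ T₁ T₀
T₁-lighter = sqrtSumLt-by-bounds (edges² I₇ T₁) (edges² I₇ T₀)
  (toWitness {a? = sum (map ⌈K√_⌉ (edges² I₇ T₁)) <? sum (map ⌊K√_⌋ (edges² I₇ T₀))} _)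

theorem7 : ∃[ I ] ∃[ T ] ( IsTour I T
                         × LocalMin I (N2optG I) T
                         × ∃[ T' ] (NswapL I T T' × Lighter I T' T) )
theorem7 = I₇ , T₀ , refl , T₀-localMin-2optG , T₁ , T₀-swapL-T₁ , T₁-lighter
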